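{- Let $G$ be a graph, $d,L\in\mathbb N$, and $\ell_G\colon V(G)\to[L]\cup\{\infty\}$ such that for every $v$ with $\ell_G(v)\ne\infty$, $|\{u\in N_G(v):\ell_G(u)\ge\ell_G(v)\}|\le d$. Let $B,k,s$ be non-negative integers with $k\ge d$ and $s>\log_2 L$. Let $v\in V(G)$ with $\ell_G(v)\ne\infty$ and $\mathrm{NumPathsIn}_{G,\ell_G}(v)\le\sqrt B$. Let $T^{(s)}_v,\mathrm{map}^{(s)}_v$ be the rooted tree and mapping obtained by calling $\mathrm{ExponentiateAndLocalPrune}(G,B,k,s)$. Then every $x\in V(T^{(s)}_v)$ that is strictly monotonically reachable with respect to $\ell_G$ satisfies $|\mathrm{Missing}_{G,T^{(s)}_v,\mathrm{map}^{(s)}_v}(x)|\le s\cdot k$.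
   Context: $[L]=\{1,\dots,L\}$, $\infty$ exceeds every integer. A path $(v_1,\dots,v_k)$ ($k\ge1$) is strictly increasing w.r.t. $\ell_G$ if $\ell_G(v_1)<\dots<\ell_G(v_k)<\infty$; $\mathrm{NumPathsIn}_{G,\ell_G}(v)$ is the number of distinct strictly increasing paths ending at $v$. For a rooted tree $T$ with mapping $\mathrm{map}\colon V(T)\to V(G)$ and $x\in V(T)$: $\mathrm{Missing}_{G,T,\mathrm{map}}(x)=N_G(\mathrm{map}(x))\setminus\{\mathrm{map}(c):c\text{ child of }x\}$; $x$ is strictly monotonically reachable w.r.t. $\ell_G$ if, writing $x=x_1,x_2,\dots,x_k=r$ for the tree path from $x$ to the root $r$, $\ell_G(\mathrm{map}(x_1))<\dots<\ell_G(\mathrm{map}(x_k))$. $\mathrm{LocalPrune}(T,k)$, for a rooted tree $T$ with root $r$: if $r$ has at most $k$ children, return $\{r\}$; otherwise for each child $c$ compute $\mathrm{LocalPrune}(T_c,k)$ ($T_c$ the subtree rooted at $c$), discard the $k$ largest of these (by node count, ties arbitrary), and return $r$ with the remaining pruned subtrees as child subtrees; mappings are restricted. $\mathrm{ExponentiateAndLocalPrune}(G,B,k,s)$: Initialization: for each $v$ with $|N_G(v)|<B$, $T^{(0)}_v$ is a root mapped to $v$ with one child mapped to each neighbor of $v$, and $v$ is marked active; for each $v$ with $|N_G(v)|\ge B$, $T^{(0)}_v$ is a single node mapped to $v$ and $v$ is inactive. For $i=1,\dots,s$: (Prune step) for every $v$, $T^{(i-1)}_{v,\mathrm{pruned}}=\mathrm{LocalPrune}(T^{(i-1)}_v,k)$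 with restricted mapping; if $|V(T^{(i-1)}_{v,\mathrm{pruned}})|>\sqrt B$, mark $v$ inactive (permanently). (Attachment step, after pruning all $v$) for every $v$: if $v$ is inactive, $T^{(i)}_v=T^{(i-1)}_{v,\mathrm{pruned}}$; otherwise let $x_1,\dots,x_\eta$ be the leaves of $T^{(i-1)}_{v,\mathrm{pruned}}$ at distance exactly $2^{i-1}$ from the root that map to an active vertex, and replace each $x_j$ by a fresh copy of $T^{(i-1)}_{u_j,\mathrm{pruned}}$, $u_j$ the image of $x_j$ (the copy's root takes the place of $x_j$), mapping inherited from the pieces. -}

module Defs where

open import Data.Nat using (ℕ; zero; suc; _+_; _*_; _^_; _≤_; _<_; _<ᵇ_; _≤ᵇ_)
open import Data.Bool using (Bool; true; false; _∧_; not; if_then_else_)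
open import Data.Fin using (Fin; _≟_)
open import Data.List using (List; []; _∷_; length; map; concatMap; _∷ʳ_; lookup)
open import Data.Bool.ListAction using (any)
open import Data.List.Membership.Propositional using (_∈_)
open import Data.List.Base using (filterᵇ)
open import Data.Vec.Functional using ()
open import Data.Product using (_×_)
open import Data.Unit using (⊤)
open import Data.Empty using (⊥)
open import Relation.Nullary using (does)
open import Relation.Binary.PropositionalEquality using (_≡_)
import Data.List as L

record Graph (n : ℕ) : Set where
  field
    adj   : Fin n → Fin n → Bool
    sym   : ∀ u v → adj u v ≡ adj v u
    irref : ∀ v → adj v v ≡ false
open Graph public

allVertices : ∀ {n} → List (Fin n)
allVertices {n} = L.allFin n

nbrs : ∀ {n} → Graph n → Fin n → List (Fin n)
nbrs G v = filterᵇ (adj G v) allVertices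

deg : ∀ {n} → Graph n → Fin n → ℕ
deg G v = length (nbrs G v)

data Lab : Set where
  fin : ℕ → Lab
  ∞   : Lab

_<L_ : Lab → Lab → Bool
fin a <L fin b = a <ᵇ b
fin a <L ∞     = true
∞     <L _     = false

_≥L_ : Lab → Lab → Bool
a ≥L b = not (a <L b)

ValidLabelling : ∀ {n} → ℕ → (Fin n → Lab) → Set
ValidLabelling {n} L ℓ = ∀ (v : Fin n) (a : ℕ) → ℓ v ≡ fin a → (1 ≤ a) × (a ≤ L)

-- Every such path has
-- distinct vertices, hence at most n vertices, so fuel n enumerates all.
incPaths : ∀ {n} → Graph n → (Fin n → Lab) → ℕ → Fin n → List (List (Fin n))
incPaths G ℓ zero    v = []
incPaths G ℓ (suc m) v with ℓ v
... | ∞     = []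
... | fin a = (v ∷ []) ∷
      concatMap (λ u → map (_∷ʳ v) (incPaths G ℓ m u))
                (filterᵇ (λ u → ℓ u <L fin a) (nbrs G v))

NumPathsIn : ∀ {n} → Graph n → (Fin n → Lab) → Fin n → ℕ
NumPathsIn {n} G ℓ v = length (incPaths G ℓ n v)

-- Rooted trees whose nodes carry their image under map

data Tree (n : ℕ) : Set where
  node : Fin n → List (Tree n) → Tree n

rootMap : ∀ {n} → Tree n → Fin n
rootMap (node a _) = a

children : ∀ {n} → Tree n → List (Tree n)
children (node _ cs) = cs

mutual
  size : ∀ {n} → Tree n → ℕ
  size (node _ cs) = suc (sizes cs)

  sizes : ∀ {n} → List (Tree n) → ℕ
  sizes []       = 0
  sizes (c ∷ cs) = size c + sizes cs

data Pos {n : ℕ} : Tree n → Set where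
  here : ∀ {t} → Pos t
  down : ∀ {a cs} (i : Fin (length cs)) → Pos (lookup cs i) → Pos (node a cs)

subtreeAt : ∀ {n} (t : Tree n) → Pos t → Tree n
subtreeAt t here = t
subtreeAt (node a cs) (down i p) = subtreeAt (lookup cs i) p

mapAt : ∀ {n} (t : Tree n) → Pos t → Fin n
mapAt t p = rootMap (subtreeAt t p)

StrictMonReach : ∀ {n} → (Fin n → Lab) → (t : Tree n) → Pos t → Set
StrictMonReach ℓ t here = ⊤
StrictMonReach ℓ (node a cs) (down i p) =
  ((ℓ (rootMap (lookup cs i)) <L ℓ a) ≡ true) × StrictMonReach ℓ (lookup cs i) p

_∈ᵇ_ : ∀ {n} → Fin n → List (Fin n) → Bool
w ∈ᵇ xs = any (λ x → does (w ≟ x)) xs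

missing : ∀ {n} → Graph n → (t : Tree n) → Pos t → List (Fin n)
missing G t p =
  filterᵇ (λ w → not (w ∈ᵇ map rootMap (children (subtreeAt t p))))
          (nbrs G (mapAt t p))

-- LocalPrune, as a relation (ties broken arbitrarily: every admissible
-- tie-breaking is a valid output)

data Split {A : Set} : List A → List A → List A → Set where
  []   : Split [] [] []
  keep : ∀ {x xs ks ds} → Split xs ks ds → Split (x ∷ xs) (x ∷ ks) ds
  drop : ∀ {x xs ks ds} → Split xs ks ds → Split (x ∷ xs) ks (x ∷ ds)

mutual
  data LocalPrune {n : ℕ} (k : ℕ) : Tree n → Tree n → Set where
    few  : ∀ {r cs} → length cs ≤ k → LocalPrune k (node r cs) (node r [])
    many : ∀ {r cs ps kept disc} →
           k < length cs →
           LocalPruneAll k cs ps →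
           Split ps kept disc →
           length disc ≡ k →
           (∀ {d e} → d ∈ disc → e ∈ kept → size e ≤ size d) →
           LocalPrune k (node r cs) (node r kept)

  data LocalPruneAll {n : ℕ} (k : ℕ) : List (Tree n) → List (Tree n) → Set where
    []  : LocalPruneAll k [] []
    _∷_ : ∀ {c cs p ps} → LocalPrune k c p → LocalPruneAll k cs ps →
          LocalPruneAll k (c ∷ cs) (p ∷ ps)

-- |V(T)| > √B   ⇔   B < |V(T)|²   (for natural numbers)
tooBig : ℕ → ℕ → Bool
tooBig B m = B <ᵇ m * m

initActive : ∀ {n} → Graph n → ℕ → Fin n → Bool
initActive G B v = deg G v <ᵇ B

initTree : ∀ {n} → Graph n → ℕ → Fin n → Tree n
initTree G B v =
  if initActive G B v
  then node v (map (λ u → node u []) (nbrs G v))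
  else node v []

mutual
  attachAt : ∀ {n} → (Fin n → Tree n) → (Fin n → Bool) → ℕ → Tree n → Tree n
  attachAt P act zero    (node u []) = if act u then P u else node u []
  attachAt P act zero    (node u (c ∷ cs)) = node u (c ∷ cs)
  attachAt P act (suc d) (node u cs) = node u (attachAll P act d cs)

  attachAll : ∀ {n} → (Fin n → Tree n) → (Fin n → Bool) → ℕ → List (Tree n) → List (Tree n)
  attachAll P act d []       = []
  attachAll P act d (c ∷ cs) = attachAt P act d c ∷ attachAll P act d cs

-- Run G B k i T act : (T, act) = (T^{(i)}_·, active-status after round i)
-- is a possible state after i rounds (all admissible tie-breakings
-- in LocalPrune are allowed).
data Run {n : ℕ} (G : Graph n) (B k : ℕ) : ℕ → (Fin n → Tree n) → (Fin n → Bool) → Set where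
  init : Run G B k zero (initTree G B) (initActive G B)
  step : ∀ {i T act T' act'} →
         Run G B k i T act →
         (P : Fin n → Tree n) →
         (∀ v → LocalPrune k (T v) (P v)) →
         (∀ v → act' v ≡ (act v ∧ not (tooBig B (size (P v))))) →
         -- round i+1 attaches at leaves of depth 2^{(i+1)-1} = 2^i
         (∀ v → T' v ≡ (if act' v then attachAt P act' (2 ^ i) (P v) else P v)) →
         Run G B k (suc i) T' act'

{-# OPTIONS --safe #-}
-- Call u good when ℓ u is finite and (NumPathsIn u)² ≤ B, and call a tree well formed when the
-- children of every node map injectively to neighbours of its image. When LocalPrune keeps any
-- children of a node u it keeps the lightest ones, and at most d ≤ k children are not below u,
-- so the kept subtrees can be charged to pruned children below u; by induction the pruned tree
-- has at most NumPathsIn u nodes. Hence good vertices are never deactivated, and goodness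
-- descends along strictly monotone tree paths. By induction on the rounds, in T⁽ⁱ⁾ of a good
-- active vertex every strictly monotone node of depth < 2ⁱ misses at most i·k neighbours or has
-- degree ≥ B: a prune adds at most k missing neighbours to a node, and attaching at the leaves
-- of depth 2ⁱ doubles the depth covered. Strictly monotone nodes lie at depth < ℓ v ≤ L < 2ˢ.
-- Finally, a good vertex of degree ≥ B with m lower neighbours satisfies
-- (1 + m)² ≤ NumPathsIn² ≤ B ≤ degree ≤ m + d, so its degree is at most d when m = 0 and at
-- most 2d otherwise, in which case L ≥ 2; either way it is at most s·k.
module Submission where

open import Algebra.Properties.CommutativeSemigroup using (x∙yz≈y∙xz)
open import Data.Bool using (Bool; true; false; not; _∧_; _∨_; if_then_else_; T)
open import Data.Bool.Properties using (T-≡)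
open import Data.Empty using (⊥-elim)
open import Data.Fin using (Fin; zero; suc; _≟_)
open import Data.List using (List; []; _∷_; length; map; filterᵇ; lookup; allFin; concatMap)
open import Data.List.Membership.Propositional using (_∈_)
open import Data.List.Membership.Propositional.Properties using (∈-allFin; ∈-lookup; ∈-filter⁺; ∈-filter⁻)
open import Data.List.Properties
  using (∷-injectiveˡ; ∷-injectiveʳ; map-cong-local; length-map; length-++; length-tabulate; length-filter;
         filter-notAll; filter-none)
open import Data.List.Relation.Binary.Sublist.Heterogeneous using (Sublist; []; _∷_; _∷ʳ_; minimum)
open import Data.List.Relation.Binary.Sublist.Heterogeneous.Properties using (length-mono-≤)
open import Data.List.Relation.Unary.All as All using (All; []; _∷_)
import Data.List.Relation.Unary.All.Properties as Allₚ
open import Data.List.Relation.Unary.AllPairs using (_∷_)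
open import Data.List.Relation.Unary.Any as Any using (here; there)
open import Data.List.Relation.Unary.Unique.Propositional using (Unique)
open import Data.List.Relation.Unary.Unique.Propositional.Properties using (filter⁺; allFin⁺)
open import Data.Nat using (ℕ; zero; suc; _+_; _*_; _^_; _≤_; _<_; _<ᵇ_; z≤n; s≤s; s≤s⁻¹; z<s)
open import Data.Nat.ListAction using (sum)
open import Data.Nat.Properties hiding (_≟_)
open import Data.Product as Product using (Σ-syntax; _×_; _,_; proj₁; proj₂)
open import Data.Sum as Sum using (_⊎_; inj₁; inj₂; [_,_]′)
open import Data.Unit using (tt)
open import Defs hiding (sym)
open import Function using (_∘_; id)
open import Function.Bundles using (Equivalence)
open import Relation.Binary.PropositionalEquality
open import Relation.Nullary using (¬_; yes; no; does)
open import Relation.Nullary.Decidable using (T?)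

if-true : ∀ {A : Set} {b : Bool} {x y : A} → b ≡ true → (if b then x else y) ≡ x
if-true refl = refl

if-false : ∀ {A : Set} {b : Bool} {x y : A} → b ≡ false → (if b then x else y) ≡ y
if-false refl = refl

∧≡true⇒ˡ : ∀ {a b} → (a ∧ b) ≡ true → a ≡ true
∧≡true⇒ˡ {true} _ = refl

≤⇒<ᵇ≡false : ∀ {m n} → n ≤ m → (m <ᵇ n) ≡ false
≤⇒<ᵇ≡false {m} {n} n≤m with m <ᵇ n in m<n
... | false = refl
... | true  = ⊥-elim (<⇒≱ (<ᵇ⇒< m n (Equivalence.from T-≡ m<n)) n≤m)

<ᵇ≡false⇒≥ : ∀ {m n} → (m <ᵇ n) ≡ false → n ≤ m
<ᵇ≡false⇒≥ m≮n = ≮⇒≥ (λ m<n → subst T m≮n (<⇒<ᵇ m<n))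

module _ {A : Set} where

  ∈-filterᵇ⁺ : (p : A → Bool) {x : A} {xs : List A} → x ∈ xs → p x ≡ true → x ∈ filterᵇ p xs
  ∈-filterᵇ⁺ p x∈xs px = ∈-filter⁺ (T? ∘ p) x∈xs (Equivalence.from T-≡ px)

  ∈-filterᵇ⁻ : (p : A → Bool) {x : A} (xs : List A) → x ∈ filterᵇ p xs → x ∈ xs × p x ≡ true
  ∈-filterᵇ⁻ p xs x∈ = Product.map₂ (Equivalence.to T-≡) (∈-filter⁻ (T? ∘ p) {xs = xs} x∈)

  All-filterᵇ : (p : A → Bool) {P : A → Set} {xs : List A} →
                All (λ x → p x ≡ true → P x) xs → All P (filterᵇ p xs)
  All-filterᵇ p [] = []
  All-filterᵇ p {xs = x ∷ _} (px⇒Px ∷ h) with p x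
  ... | true  = px⇒Px refl ∷ All-filterᵇ p h
  ... | false = All-filterᵇ p h

  length-filterᵇ-mono : (p q : A → Bool) → (∀ x → p x ≡ true → q x ≡ true) → ∀ xs →
                        length (filterᵇ p xs) ≤ length (filterᵇ q xs)
  length-filterᵇ-mono p q p⇒q [] = z≤n
  length-filterᵇ-mono p q p⇒q (x ∷ xs) with p x in px | q x in qx
  ... | true  | true  = s≤s (length-filterᵇ-mono p q p⇒q xs)
  ... | true  | false with () ← trans (sym (p⇒q x px)) qx
  ... | false | true  = m≤n⇒m≤1+n (length-filterᵇ-mono p q p⇒q xs)
  ... | false | false = length-filterᵇ-mono p q p⇒q xs

  length-filterᵇ-mono-< : (p q : A → Bool) → (∀ x → p x ≡ true → q x ≡ true) →
                          ∀ {y xs} → y ∈ xs → p y ≡ false → q y ≡ true →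
                          length (filterᵇ p xs) < length (filterᵇ q xs)
  length-filterᵇ-mono-< p q p⇒q {xs = _ ∷ xs} (here refl) py qy rewrite py | qy =
    s≤s (length-filterᵇ-mono p q p⇒q xs)
  length-filterᵇ-mono-< p q p⇒q {xs = x ∷ xs} (there y∈) py qy with p x in px | q x in qx
  ... | true  | true  = s≤s (length-filterᵇ-mono-< p q p⇒q y∈ py qy)
  ... | true  | false with () ← trans (sym (p⇒q x px)) qx
  ... | false | true  = m<n⇒m<1+n (length-filterᵇ-mono-< p q p⇒q y∈ py qy)
  ... | false | false = length-filterᵇ-mono-< p q p⇒q y∈ py qy

  length-filterᵇ-∨ : (p q : A → Bool) → ∀ xs →
                     length (filterᵇ (λ x → p x ∨ q x) xs) ≤ length (filterᵇ p xs) + length (filterᵇ q xs)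
  length-filterᵇ-∨ p q [] = z≤n
  length-filterᵇ-∨ p q (x ∷ xs) with p x | q x | length-filterᵇ-∨ p q xs
  ... | true  | true  | ih = s≤s (≤-trans ih (+-monoʳ-≤ _ (n≤1+n _)))
  ... | true  | false | ih = s≤s ih
  ... | false | true  | ih = ≤-trans (s≤s ih) (≤-reflexive (sym (+-suc _ _)))
  ... | false | false | ih = ih

  sum-map-mono : {f g : A → ℕ} {xs : List A} → All (λ x → f x ≤ g x) xs → sum (map f xs) ≤ sum (map g xs)
  sum-map-mono []         = z≤n
  sum-map-mono (fx≤gx ∷ h) = +-mono-≤ fx≤gx (sum-map-mono h)

  sum-map-∈ : (f : A → ℕ) {x : A} {xs : List A} → x ∈ xs → f x ≤ sum (map f xs)
  sum-map-∈ f {xs = y ∷ _}  (here refl) = m≤m+n (f y) _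
  sum-map-∈ f {xs = y ∷ _}  (there x∈)  = ≤-trans (sum-map-∈ f x∈) (m≤n+m _ (f y))

  length≤sum-map : (f : A → ℕ) {xs : List A} → All (λ x → 1 ≤ f x) xs → length xs ≤ sum (map f xs)
  length≤sum-map f []          = z≤n
  length≤sum-map f (1≤fx ∷ h) = +-mono-≤ 1≤fx (length≤sum-map f h)

  sum-map-dominated : (f : A → ℕ) {xs ys : List A} → (∀ {x y} → x ∈ xs → y ∈ ys → f x ≤ f y) →
                      length xs ≤ length ys → sum (map f xs) ≤ sum (map f ys)
  sum-map-dominated f {[]}     _ _ = z≤n
  sum-map-dominated f {_ ∷ _} {_ ∷ _} xs≤ys (s≤s len≤) =
    +-mono-≤ (xs≤ys (here refl) (here refl)) (sum-map-dominated f (λ x∈ y∈ → xs≤ys (there x∈) (there y∈)) len≤)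

  length-concatMap-map : {B C : Set} (g : B → C) (f : A → List B) (xs : List A) →
                         length (concatMap (map g ∘ f) xs) ≡ sum (map (length ∘ f) xs)
  length-concatMap-map g f []       = refl
  length-concatMap-map g f (x ∷ xs) =
    trans (length-++ (map g (f x))) (cong₂ _+_ (length-map g (f x)) (length-concatMap-map g f xs))

  filterᵇ-Split : (p : A → Bool) (xs : List A) → Split xs (filterᵇ p xs) (filterᵇ (not ∘ p) xs)
  filterᵇ-Split p []       = []
  filterᵇ-Split p (x ∷ xs) with p x
  ... | true  = keep (filterᵇ-Split p xs)
  ... | false = drop (filterᵇ-Split p xs)

  Split-filterᵇ⁺ : (p : A → Bool) {xs K D : List A} → Split xs K D →
                 Split (filterᵇ p xs) (filterᵇ p K) (filterᵇ p D)
  Split-filterᵇ⁺ p []                = []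
  Split-filterᵇ⁺ p (keep {x} sp) with p x
  ... | true  = keep (Split-filterᵇ⁺ p sp)
  ... | false = Split-filterᵇ⁺ p sp
  Split-filterᵇ⁺ p (drop {x} sp) with p x
  ... | true  = drop (Split-filterᵇ⁺ p sp)
  ... | false = Split-filterᵇ⁺ p sp

  Split-map⁺ : {C : Set} (f : A → C) {xs K D : List A} → Split xs K D → Split (map f xs) (map f K) (map f D)
  Split-map⁺ f []        = []
  Split-map⁺ f (keep sp) = keep (Split-map⁺ f sp)
  Split-map⁺ f (drop sp) = drop (Split-map⁺ f sp)

  Split-length : {xs K D : List A} → Split xs K D → length xs ≡ length K + length D
  Split-length []                       = refl
  Split-length (keep sp)                = cong suc (Split-length sp)
  Split-length (drop {ks = K} {D} sp) = trans (cong suc (Split-length sp)) (sym (+-suc (length K) (length D)))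

  Split-sum : (f : A → ℕ) {xs K D : List A} → Split xs K D → sum (map f xs) ≡ sum (map f K) + sum (map f D)
  Split-sum f []                          = refl
  Split-sum f (keep {x} sp)               = trans (cong (f x +_) (Split-sum f sp)) (sym (+-assoc (f x) _ _))
  Split-sum f (drop {x} {ks = K} {D} sp) =
    trans (cong (f x +_) (Split-sum f sp)) (x∙yz≈y∙xz +-commutativeSemigroup (f x) (sum (map f K)) (sum (map f D)))

  Split-∈ : {xs K D : List A} {x : A} → Split xs K D → x ∈ xs → x ∈ K ⊎ x ∈ D
  Split-∈ (keep sp) (here refl) = inj₁ (here refl)
  Split-∈ (drop sp) (here refl) = inj₂ (here refl)
  Split-∈ (keep sp) (there x∈)  = Sum.map₁ there (Split-∈ sp x∈)
  Split-∈ (drop sp) (there x∈)  = Sum.map₂ there (Split-∈ sp x∈)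

  Split-All : {P : A → Set} {xs K D : List A} → Split xs K D → All P xs → All P K
  Split-All []        []        = []
  Split-All (keep sp) (px ∷ ps) = px ∷ Split-All sp ps
  Split-All (drop sp) (_ ∷ ps)  = Split-All sp ps

  Split-lookup-kept : {xs K D : List A} → Split xs K D → (i : Fin (length K)) →
                      Σ[ j ∈ Fin (length xs) ] lookup xs j ≡ lookup K i
  Split-lookup-kept (keep sp) zero = zero , refl
  Split-lookup-kept (keep sp) (suc i) with Split-lookup-kept sp i
  ... | j , eq = suc j , eq
  Split-lookup-kept (drop sp) i with Split-lookup-kept sp i
  ... | j , eq = suc j , eq

  -- The kept elements failing p are no more numerous than the discarded ones satisfying p,
  -- and each is no heavier than any of those.
  sum-kept≤sum-filterᵇ : (f : A → ℕ) (p : A → Bool) {xs K D : List A} → Split xs K D →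
                         (∀ {y x} → y ∈ D → x ∈ K → f x ≤ f y) →
                         length (filterᵇ (not ∘ p) xs) ≤ length D →
                         sum (map f K) ≤ sum (map f (filterᵇ p xs))
  sum-kept≤sum-filterᵇ f p {xs} {K} {D} sp K≤D fails≤ = begin
    sum (map f K)
      ≡⟨ Split-sum f (filterᵇ-Split p K) ⟩
    sum (map f (filterᵇ p K)) + sum (map f (filterᵇ (not ∘ p) K))
      ≤⟨ +-monoʳ-≤ _ (sum-map-dominated f lighter fewer) ⟩
    sum (map f (filterᵇ p K)) + sum (map f (filterᵇ p D))
      ≡⟨ Split-sum f (Split-filterᵇ⁺ p sp) ⟨
    sum (map f (filterᵇ p xs)) ∎
    where
    open ≤-Reasoning
    lighter : ∀ {x y} → x ∈ filterᵇ (not ∘ p) K → y ∈ filterᵇ p D → f x ≤ f y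
    lighter x∈ y∈ = K≤D (proj₁ (∈-filterᵇ⁻ p D y∈)) (proj₁ (∈-filterᵇ⁻ (not ∘ p) K x∈))
    fewer : length (filterᵇ (not ∘ p) K) ≤ length (filterᵇ p D)
    fewer = +-cancelʳ-≤ (length (filterᵇ (not ∘ p) D)) _ _ (begin
      length (filterᵇ (not ∘ p) K) + length (filterᵇ (not ∘ p) D) ≡⟨ Split-length (Split-filterᵇ⁺ (not ∘ p) sp) ⟨
      length (filterᵇ (not ∘ p) xs)                              ≤⟨ fails≤ ⟩
      length D                                                    ≡⟨ Split-length (filterᵇ-Split p D) ⟩
      length (filterᵇ p D) + length (filterᵇ (not ∘ p) D)         ∎)

module _ {n : ℕ} where

  ∈ᵇ⇒∈ : {w : Fin n} (xs : List (Fin n)) → (w ∈ᵇ xs) ≡ true → w ∈ xs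
  ∈ᵇ⇒∈ {w} (x ∷ xs) w∈ᵇ with w ≟ x
  ... | yes refl = here refl
  ... | no _     = there (∈ᵇ⇒∈ xs w∈ᵇ)

  ∈⇒∈ᵇ : {w : Fin n} {xs : List (Fin n)} → w ∈ xs → (w ∈ᵇ xs) ≡ true
  ∈⇒∈ᵇ {w} {x ∷ _} w∈ with w ≟ x | w∈
  ... | yes _  | _          = refl
  ... | no w≢x | here w≡x   = ⊥-elim (w≢x w≡x)
  ... | no _   | there w∈xs = ∈⇒∈ᵇ w∈xs

  length-filterᵇ-≟≤1 : (x : Fin n) {xs : List (Fin n)} → Unique xs → length (filterᵇ (λ w → does (w ≟ x)) xs) ≤ 1
  length-filterᵇ-≟≤1 x {[]}     _            = z≤n
  length-filterᵇ-≟≤1 x {y ∷ xs} (y∉xs ∷ u) with y ≟ x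
  ... | no _     = length-filterᵇ-≟≤1 x u
  ... | yes refl = s≤s (≤-reflexive (cong length (filter-none (T? ∘ λ w → does (w ≟ x)) (All.map ≢⇒¬≟ y∉xs))))
    where
    ≢⇒¬≟ : ∀ {w} → x ≢ w → ¬ T (does (w ≟ x))
    ≢⇒¬≟ {w} x≢w w≟x with w ≟ x
    ... | yes w≡x = x≢w (sym w≡x)

  length-filterᵇ-∈ᵇ≤ : (D : List (Fin n)) {xs : List (Fin n)} → Unique xs → length (filterᵇ (_∈ᵇ D) xs) ≤ length D
  length-filterᵇ-∈ᵇ≤ []      {xs} _ = ≤-reflexive (cong length (filter-none (T? ∘ (_∈ᵇ [])) (All.universal (λ _ ()) xs)))
  length-filterᵇ-∈ᵇ≤ (x ∷ D) {xs} u =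
    ≤-trans (length-filterᵇ-∨ (λ w → does (w ≟ x)) (_∈ᵇ D) xs)
            (+-mono-≤ (length-filterᵇ-≟≤1 x u) (length-filterᵇ-∈ᵇ≤ D u))

  nbrs-unique : (G : Graph n) (u : Fin n) → Unique (nbrs G u)
  nbrs-unique G u = filter⁺ (T? ∘ adj G u) (allFin⁺ n)

  _∖_ : List (Fin n) → List (Fin n) → List (Fin n)
  N ∖ K = filterᵇ (λ w → not (w ∈ᵇ K)) N

  ∖-⊆ : ∀ {N K : List (Fin n)} → (∀ {w} → w ∈ N → w ∈ K) → N ∖ K ≡ []
  ∖-⊆ N⊆K = filter-none (T? ∘ _) (All.tabulate λ w∈N → subst (T ∘ not) (∈⇒∈ᵇ (N⊆K w∈N)))

  length-∖-≤ : (N K C D : List (Fin n)) → Unique N → (∀ {w} → w ∈ C → w ∈ K ⊎ w ∈ D) →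
               length (N ∖ K) ≤ length (N ∖ C) + length D
  length-∖-≤ N K C D u C⊆K∪D =
    ≤-trans (length-filterᵇ-mono (λ w → not (w ∈ᵇ K)) (λ w → not (w ∈ᵇ C) ∨ (w ∈ᵇ D)) outside N)
            (≤-trans (length-filterᵇ-∨ (λ w → not (w ∈ᵇ C)) (_∈ᵇ D) N)
                     (+-monoʳ-≤ (length (N ∖ C)) (length-filterᵇ-∈ᵇ≤ D u)))
    where
    outside : ∀ w → not (w ∈ᵇ K) ≡ true → (not (w ∈ᵇ C) ∨ (w ∈ᵇ D)) ≡ true
    outside w w∉K with w ∈ᵇ C in w∈C
    ... | false = refl
    ... | true with C⊆K∪D (∈ᵇ⇒∈ {w} C w∈C)
    ...   | inj₂ w∈D = ∈⇒∈ᵇ w∈D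
    ...   | inj₁ w∈K with () ← subst (λ b → not b ≡ true) (∈⇒∈ᵇ w∈K) w∉K

<L-fin : ∀ {x y} → (fin x <L fin y) ≡ true → x < y
<L-fin {x} {y} x<y = <ᵇ⇒< x y (Equivalence.from T-≡ x<y)

<L-trans : ∀ a b c → (a <L b) ≡ true → (b <L c) ≡ true → (a <L c) ≡ true
<L-trans (fin x) (fin y) (fin z) x<y y<z = Equivalence.to T-≡ (<⇒<ᵇ (<-trans (<L-fin {x} {y} x<y) (<L-fin {y} {z} y<z)))
<L-trans (fin x) (fin y) ∞       _   _   = refl
<L-trans (fin x) ∞       c       _   ()
<L-trans ∞       b       c       ()  _

<L-irrefl : ∀ a → (a <L a) ≡ false
<L-irrefl (fin x) = ≤⇒<ᵇ≡false {x} ≤-refl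
<L-irrefl ∞ = refl

Lab-cases : (a : Lab) → a ≡ ∞ ⊎ Σ[ x ∈ ℕ ] a ≡ fin x
Lab-cases (fin x) = inj₂ (x , refl)
Lab-cases ∞       = inj₁ refl

<L⇒≢∞ : ∀ {a b} → (a <L b) ≡ true → a ≢ ∞
<L⇒≢∞ {fin _} _ ()
<L⇒≢∞ {∞}     ()

depth : ∀ {n} {t : Tree n} → Pos t → ℕ
depth here       = 0
depth (down _ x) = suc (depth x)

Height : ∀ {n} → ℕ → Tree n → Set
Height D t = (x : Pos t) → depth x ≤ D

k≤s*k : ∀ {L} s k → 1 ≤ L → L < 2 ^ s → k ≤ s * k
k≤s*k zero    k 1≤L L<1 = ⊥-elim (<⇒≱ L<1 1≤L)
k≤s*k (suc s) k _   _   = m≤m+n k (s * k)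

k+k≤s*k : ∀ {L} s k → 2 ≤ L → L < 2 ^ s → k + k ≤ s * k
k+k≤s*k zero          k 2≤L L<1 = ⊥-elim (<⇒≱ L<1 (≤-trans (s≤s z≤n) 2≤L))
k+k≤s*k (suc zero)    k 2≤L L<2 = ⊥-elim (<⇒≱ L<2 2≤L)
k+k≤s*k (suc (suc s)) k _   _   = +-monoʳ-≤ k (m≤m+n k (s * k))

module Labelling {n L : ℕ} {ℓ : Fin n → Lab} (valid : ValidLabelling L ℓ) where

  label≤L : ∀ {u} → ℓ u ≢ ∞ → Σ[ a ∈ ℕ ] ℓ u ≡ fin a × 1 ≤ a × a ≤ L
  label≤L {u} ℓu≢∞ with Lab-cases (ℓ u)
  ... | inj₁ ℓu≡∞      = ⊥-elim (ℓu≢∞ ℓu≡∞)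
  ... | inj₂ (a , ℓu≡a) = a , ℓu≡a , valid u a ℓu≡a

  finite⇒1≤L : ∀ {u} → ℓ u ≢ ∞ → 1 ≤ L
  finite⇒1≤L ℓu≢∞ = let _ , _ , 1≤a , a≤L = label≤L ℓu≢∞ in ≤-trans 1≤a a≤L

  below⇒2≤L : ∀ {c u} → (ℓ c <L ℓ u) ≡ true → ℓ u ≢ ∞ → 2 ≤ L
  below⇒2≤L c<u ℓu≢∞ =
    let a , ℓu≡a , _ , a≤L = label≤L ℓu≢∞
        b , ℓc≡b , 1≤b , _ = label≤L (<L⇒≢∞ c<u)
    in ≤-trans (s≤s 1≤b) (≤-trans (<L-fin (subst₂ (λ x y → (x <L y) ≡ true) ℓc≡b ℓu≡a c<u)) a≤L)

  depth<label : ∀ t (x : Pos t) {a} → ℓ (rootMap t) ≡ fin a → StrictMonReach ℓ t x → depth x < a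
  depth<label t here ℓr≡a _ = proj₁ (valid (rootMap t) _ ℓr≡a)
  depth<label (node r cs) (down i x) ℓr≡a (below , mon) with Lab-cases (ℓ (rootMap (lookup cs i)))
  ... | inj₁ ℓc≡∞      = ⊥-elim (<L⇒≢∞ below ℓc≡∞)
  ... | inj₂ (b , ℓc≡b) =
    ≤-trans (s≤s (depth<label (lookup cs i) x ℓc≡b mon))
            (<L-fin (subst₂ (λ a b → (a <L b) ≡ true) ℓc≡b ℓr≡a below))

module Paths {n : ℕ} (G : Graph n) (ℓ : Fin n → Lab) where

  lower : Fin n → Fin n → Bool
  lower u w = ℓ w <L ℓ u

  lowerNbrs : Fin n → List (Fin n)
  lowerNbrs u = filterᵇ (lower u) (nbrs G u)

  ∈lowerNbrs⇒lower : ∀ {u w} → w ∈ lowerNbrs u → lower u w ≡ true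
  ∈lowerNbrs⇒lower {u} w∈ = proj₂ (∈-filterᵇ⁻ (lower u) (nbrs G u) w∈)

  rank : Fin n → ℕ
  rank u = length (filterᵇ (lower u) allVertices)

  rank-mono : ∀ {u w} → lower u w ≡ true → rank w < rank u
  rank-mono {u} {w} w<u = length-filterᵇ-mono-< (lower w) (lower u) (λ x x<w → <L-trans (ℓ x) (ℓ w) (ℓ u) x<w w<u)
                                                (∈-allFin w) (<L-irrefl (ℓ w)) w<u

  rank<n : ∀ u → rank u < n
  rank<n u = subst (rank u <_) (length-tabulate id)
               (filter-notAll (T? ∘ lower u) (allFin n) (Any.map (λ { refl → subst T (<L-irrefl (ℓ u)) }) (∈-allFin u)))

  private
    count : ℕ → Fin n → ℕ
    count m u = length (incPaths G ℓ m u)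

    count-∞ : ∀ m {u} → ℓ u ≡ ∞ → count m u ≡ 0
    count-∞ zero    _ = refl
    count-∞ (suc m) {u} ℓu≡∞ with ℓ u
    count-∞ (suc m) refl | .∞ = refl

    count-unfold : ∀ m {u a} → ℓ u ≡ fin a →
                   count (suc m) u ≡ suc (sum (map (count m) (filterᵇ (λ w → ℓ w <L ℓ u) (nbrs G u))))
    count-unfold m {u} {a} ℓu≡a with ℓ u
    count-unfold m {u} {a} refl | .(fin a) =
      cong suc (length-concatMap-map _ (incPaths G ℓ m) (filterᵇ (λ w → ℓ w <L fin a) (nbrs G u)))

    -- Every vertex of a strictly increasing path into u other than u has a smaller label,
    -- so such paths have at most rank u + 1 vertices.
    count-saturated : ∀ m u → rank u < m → count m u ≡ count (suc m) u
    count-saturated (suc m) u rank<m with Lab-cases (ℓ u)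
    ... | inj₁ ℓu     = trans (count-∞ (suc m) ℓu) (sym (count-∞ (suc (suc m)) ℓu))
    ... | inj₂ (a , ℓu) = begin
      count (suc m) u                                   ≡⟨ count-unfold m ℓu ⟩
      suc (sum (map (count m) (lowerNbrs u)))           ≡⟨ cong (suc ∘ sum) (map-cong-local (All.tabulate saturated)) ⟩
      suc (sum (map (count (suc m)) (lowerNbrs u)))     ≡⟨ count-unfold (suc m) ℓu ⟨
      count (suc (suc m)) u                             ∎
      where
      open ≡-Reasoning
      saturated : ∀ {w} → w ∈ lowerNbrs u → count m w ≡ count (suc m) w
      saturated {w} w∈ = count-saturated m w (<-≤-trans (rank-mono (∈lowerNbrs⇒lower w∈)) (s≤s⁻¹ rank<m))

  NumPathsIn-unfold : ∀ {u} → ℓ u ≢ ∞ → NumPathsIn G ℓ u ≡ suc (sum (map (NumPathsIn G ℓ) (lowerNbrs u)))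
  NumPathsIn-unfold {u} ℓu≢∞ with Lab-cases (ℓ u)
  ... | inj₁ ℓu     = ⊥-elim (ℓu≢∞ ℓu)
  ... | inj₂ (a , ℓu) = trans (count-saturated n u (rank<n u)) (count-unfold n ℓu)

  NumPathsIn-pos : ∀ {u} → ℓ u ≢ ∞ → 0 < NumPathsIn G ℓ u
  NumPathsIn-pos ℓu≢∞ rewrite NumPathsIn-unfold ℓu≢∞ = z<s

  NumPathsIn-lower : ∀ {u w} → ℓ u ≢ ∞ → w ∈ lowerNbrs u → NumPathsIn G ℓ w < NumPathsIn G ℓ u
  NumPathsIn-lower ℓu≢∞ w∈ rewrite NumPathsIn-unfold ℓu≢∞ = s≤s (sum-map-∈ (NumPathsIn G ℓ) w∈)

  lowerDegree<NumPathsIn : ∀ {u} → ℓ u ≢ ∞ → length (lowerNbrs u) < NumPathsIn G ℓ u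
  lowerDegree<NumPathsIn {u} ℓu≢∞ rewrite NumPathsIn-unfold ℓu≢∞ =
    s≤s (length≤sum-map (NumPathsIn G ℓ) (All.tabulate λ w∈ → NumPathsIn-pos (<L⇒≢∞ (∈lowerNbrs⇒lower w∈))))

module Trees {n : ℕ} (G : Graph n) where

  sizes≡sum : (cs : List (Tree n)) → sizes cs ≡ sum (map size cs)
  sizes≡sum []       = refl
  sizes≡sum (c ∷ cs) = cong (size c +_) (sizes≡sum cs)

  rootMissing : Tree n → List (Fin n)
  rootMissing s = nbrs G (rootMap s) ∖ map rootMap (children s)

  missing≤deg : (t : Tree n) (x : Pos t) → length (missing G t x) ≤ deg G (mapAt t x)
  missing≤deg t x = length-filter (T? ∘ _) (nbrs G (mapAt t x))

  RootsIn : List (Tree n) → List (Fin n) → Set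
  RootsIn = Sublist (λ c w → rootMap c ≡ w)

  data WellFormed : Tree n → Set where
    wf : ∀ {a cs} → RootsIn cs (nbrs G a) → All WellFormed cs → WellFormed (node a cs)

  RootsIn-∈ : ∀ {cs ws c} → RootsIn cs ws → c ∈ cs → rootMap c ∈ ws
  RootsIn-∈ (w ∷ʳ roots)    c∈          = there (RootsIn-∈ roots c∈)
  RootsIn-∈ (refl ∷ roots) (here refl) = here refl
  RootsIn-∈ (_ ∷ roots)    (there c∈)  = there (RootsIn-∈ roots c∈)

  RootsIn-filterᵇ : (q : Fin n → Bool) → ∀ {cs ws} → RootsIn cs ws → RootsIn (filterᵇ (q ∘ rootMap) cs) (filterᵇ q ws)
  RootsIn-filterᵇ q []                 = []
  RootsIn-filterᵇ q (w ∷ʳ roots) with q w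
  ... | true  = w ∷ʳ RootsIn-filterᵇ q roots
  ... | false = RootsIn-filterᵇ q roots
  RootsIn-filterᵇ q {c ∷ _} (refl ∷ roots) with q (rootMap c)
  ... | true  = refl ∷ RootsIn-filterᵇ q roots
  ... | false = RootsIn-filterᵇ q roots

  RootsIn-sum : (f : Fin n → ℕ) → ∀ {cs ws} → RootsIn cs ws → sum (map (f ∘ rootMap) cs) ≤ sum (map f ws)
  RootsIn-sum f []              = z≤n
  RootsIn-sum f (w ∷ʳ roots)    = ≤-trans (RootsIn-sum f roots) (m≤n+m _ (f w))
  RootsIn-sum f (refl ∷ roots) = +-monoʳ-≤ _ (RootsIn-sum f roots)

  RootsIn-resp : ∀ {cs ps ws} → map rootMap cs ≡ map rootMap ps → RootsIn cs ws → RootsIn ps ws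
  RootsIn-resp {ps = []}    _  []              = []
  RootsIn-resp              eq (w ∷ʳ roots)    = w ∷ʳ RootsIn-resp eq roots
  RootsIn-resp {ps = _ ∷ _} eq (refl ∷ roots) = sym (∷-injectiveˡ eq) ∷ RootsIn-resp (∷-injectiveʳ eq) roots

module Pruning {n : ℕ} (G : Graph n) (ℓ : Fin n → Lab) (k : ℕ) where
  open Paths G ℓ
  open Trees G

  prune-root : ∀ {t p : Tree n} → LocalPrune k t p → rootMap p ≡ rootMap t
  prune-root (few _)          = refl
  prune-root (many _ _ _ _ _) = refl

  pruneAll-roots : ∀ {cs ps : List (Tree n)} → LocalPruneAll k cs ps → map rootMap cs ≡ map rootMap ps
  pruneAll-roots []          = refl
  pruneAll-roots (lp ∷ lps) = cong₂ _∷_ (sym (prune-root lp)) (pruneAll-roots lps)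

  Split-RootsIn : ∀ {ps K D : List (Tree n)} {ws} → Split ps K D → RootsIn ps ws → RootsIn K ws
  Split-RootsIn sp          (w ∷ʳ roots) = w ∷ʳ Split-RootsIn sp roots
  Split-RootsIn []          []           = []
  Split-RootsIn (keep sp) (r ∷ roots)  = r ∷ Split-RootsIn sp roots
  Split-RootsIn (drop sp) (_ ∷ roots)  = _ ∷ʳ Split-RootsIn sp roots

  prune-wellFormed : ∀ {t p : Tree n} → LocalPrune k t p → WellFormed t → WellFormed p
  pruneAll-wellFormed : ∀ {cs ps : List (Tree n)} → LocalPruneAll k cs ps → All WellFormed cs → All WellFormed ps
  prune-wellFormed (few _)                 (wf _ _)       = wf (minimum _) []
  prune-wellFormed (many _ lps sp _ _) (wf roots wfs) =
    wf (Split-RootsIn sp (RootsIn-resp (pruneAll-roots lps) roots)) (Split-All sp (pruneAll-wellFormed lps wfs))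
  pruneAll-wellFormed []          []          = []
  pruneAll-wellFormed (lp ∷ lps) (w ∷ wfs) = prune-wellFormed lp w ∷ pruneAll-wellFormed lps wfs

  prune-rootMissing : ∀ {t p : Tree n} → LocalPrune k t p → length (rootMissing p) ≤ length (rootMissing t) + k
  prune-rootMissing (few {r} {cs} cs≤k) =
    ≤-trans (length-∖-≤ (nbrs G r) [] (map rootMap cs) (map rootMap cs) (nbrs-unique G r) inj₂)
            (+-monoʳ-≤ _ (≤-trans (≤-reflexive (length-map rootMap cs)) cs≤k))
  prune-rootMissing (many {r} {cs} {ps} {kept} {disc} _ lps sp disc≡k _) =
    ≤-trans (length-∖-≤ (nbrs G r) (map rootMap kept) (map rootMap cs) (map rootMap disc) (nbrs-unique G r) keptOrDiscarded)
            (+-monoʳ-≤ _ (≤-reflexive (trans (length-map rootMap disc) disc≡k)))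
    where
    keptOrDiscarded : ∀ {w} → w ∈ map rootMap cs → w ∈ map rootMap kept ⊎ w ∈ map rootMap disc
    keptOrDiscarded w∈ = Split-∈ (Split-map⁺ rootMap sp) (subst (_ ∈_) (pruneAll-roots lps) w∈)

  pruneAll-lookup : ∀ {cs ps : List (Tree n)} → LocalPruneAll k cs ps → (j : Fin (length ps)) →
                    Σ[ j′ ∈ Fin (length cs) ] LocalPrune k (lookup cs j′) (lookup ps j)
  pruneAll-lookup (lp ∷ _)   zero    = zero , lp
  pruneAll-lookup (_ ∷ lps) (suc j) with pruneAll-lookup lps j
  ... | j′ , lp = suc j′ , lp

  record Origin (t p : Tree n) (y : Pos p) : Set where
    field
      position    : Pos t
      depth≡      : depth position ≡ depth y
      mapAt≡      : mapAt t position ≡ mapAt p y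
      missing≤    : length (missing G p y) ≤ length (missing G t position) + k
      monotone    : StrictMonReach ℓ p y → StrictMonReach ℓ t position

  prune-origin : ∀ {t p : Tree n} → LocalPrune k t p → (y : Pos p) → Origin t p y
  prune-origin lp here = record
    { position = here
    ; depth≡   = refl
    ; mapAt≡   = sym (prune-root lp)
    ; missing≤ = prune-rootMissing lp
    ; monotone = λ _ → tt
    }
  prune-origin (many {r} {cs} _ lps sp _ _) (down i y) =
    let j  , ps[j]≡kept[i] = Split-lookup-kept sp i
        j′ , lp            = pruneAll-lookup lps j
        lp′ = subst (LocalPrune k (lookup cs j′)) ps[j]≡kept[i] lp
        o   = prune-origin lp′ y
    in record
    { position = down j′ (Origin.position o)
    ; depth≡   = cong suc (Origin.depth≡ o)
    ; mapAt≡   = Origin.mapAt≡ o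
    ; missing≤ = Origin.missing≤ o
    ; monotone = λ (below , mon) → subst (λ w → (ℓ w <L ℓ r) ≡ true) (prune-root lp′) below , Origin.monotone o mon
    }

  module _ {d : ℕ} (higher≤d : ∀ v → ℓ v ≢ ∞ → length (filterᵇ (λ u → ℓ u ≥L ℓ v) (nbrs G v)) ≤ d)
           (d≤k : d ≤ k) where

    size-prune : ∀ {t p : Tree n} → WellFormed t → ℓ (rootMap t) ≢ ∞ → LocalPrune k t p →
                 size p ≤ NumPathsIn G ℓ (rootMap t)
    size-pruneAll : ∀ {cs ps : List (Tree n)} → All WellFormed cs → LocalPruneAll k cs ps →
                    All (λ p → ℓ (rootMap p) ≢ ∞ → size p ≤ NumPathsIn G ℓ (rootMap p)) ps

    size-prune _ ℓr≢∞ (few _) = NumPathsIn-pos ℓr≢∞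
    size-prune (wf roots wfs) ℓr≢∞ (many {r} {cs} {ps} {kept} {disc} _ lps sp disc≡k kept≤disc) = begin
      suc (sizes kept)
        ≡⟨ cong suc (sizes≡sum kept) ⟩
      suc (sum (map size kept))
        ≤⟨ s≤s (sum-kept≤sum-filterᵇ size (lower r ∘ rootMap) sp kept≤disc higher≤disc) ⟩
      suc (sum (map size (filterᵇ (lower r ∘ rootMap) ps)))
        ≤⟨ s≤s (sum-map-mono (All-filterᵇ (lower r ∘ rootMap) lowerBounds)) ⟩
      suc (sum (map (NumPathsIn G ℓ ∘ rootMap) (filterᵇ (lower r ∘ rootMap) ps)))
        ≤⟨ s≤s (RootsIn-sum (NumPathsIn G ℓ) (RootsIn-filterᵇ (lower r) roots′)) ⟩
      suc (sum (map (NumPathsIn G ℓ) (lowerNbrs r)))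
        ≡⟨ NumPathsIn-unfold ℓr≢∞ ⟨
      NumPathsIn G ℓ r ∎
      where
      open ≤-Reasoning
      roots′ : RootsIn ps (nbrs G r)
      roots′ = RootsIn-resp (pruneAll-roots lps) roots
      higher≤disc : length (filterᵇ (not ∘ lower r ∘ rootMap) ps) ≤ length disc
      higher≤disc = begin
        length (filterᵇ (not ∘ lower r ∘ rootMap) ps)    ≤⟨ length-mono-≤ (RootsIn-filterᵇ (not ∘ lower r) roots′) ⟩
        length (filterᵇ (not ∘ lower r) (nbrs G r))      ≤⟨ higher≤d r ℓr≢∞ ⟩
        d                                                ≤⟨ d≤k ⟩
        k                                                ≡⟨ disc≡k ⟨
        length disc                                      ∎
      lowerBounds : All (λ p → lower r (rootMap p) ≡ true → size p ≤ NumPathsIn G ℓ (rootMap p)) ps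
      lowerBounds = All.map (λ bound below → bound (<L⇒≢∞ below)) (size-pruneAll wfs lps)

    size-pruneAll []          []          = []
    size-pruneAll {ps = p ∷ _} (w ∷ wfs) (lp ∷ lps) = bound ∷ size-pruneAll wfs lps
      where
      bound : ℓ (rootMap p) ≢ ∞ → size p ≤ NumPathsIn G ℓ (rootMap p)
      bound rewrite prune-root lp = λ ℓc≢∞ → size-prune w ℓc≢∞ lp

module Attaching {n : ℕ} (G : Graph n) (ℓ : Fin n → Lab) (P : Fin n → Tree n) (act : Fin n → Bool)
                 (root-P : ∀ w → rootMap (P w) ≡ w) where
  open Trees G

  attach-root : ∀ D t → rootMap (attachAt P act D t) ≡ rootMap t
  attach-root zero    (node u [])      with act u
  ... | true  = root-P u
  ... | false = refl
  attach-root zero    (node u (_ ∷ _)) = refl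
  attach-root (suc D) (node u cs)      = refl

  attachAll-roots : ∀ D cs → map rootMap (attachAll P act D cs) ≡ map rootMap cs
  attachAll-roots D []       = refl
  attachAll-roots D (c ∷ cs) = cong₂ _∷_ (attach-root D c) (attachAll-roots D cs)

  attach-wellFormed : (∀ w → WellFormed (P w)) → ∀ D {t} → WellFormed t → WellFormed (attachAt P act D t)
  attachAll-wellFormed : (∀ w → WellFormed (P w)) → ∀ D {cs} → All WellFormed cs → All WellFormed (attachAll P act D cs)
  attach-wellFormed wf-P zero    {node u []}      w with act u
  ... | true  = wf-P u
  ... | false = w
  attach-wellFormed wf-P zero    {node u (_ ∷ _)} w = w
  attach-wellFormed wf-P (suc D) {node u cs} (wf roots wfs) =
    wf (RootsIn-resp (sym (attachAll-roots D cs)) roots) (attachAll-wellFormed wf-P D wfs)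
  attachAll-wellFormed wf-P D []          = []
  attachAll-wellFormed wf-P D (w ∷ wfs) = attach-wellFormed wf-P D w ∷ attachAll-wellFormed wf-P D wfs

  lookup-attachAll : ∀ D cs (i : Fin (length (attachAll P act D cs))) →
                     Σ[ j ∈ Fin (length cs) ] lookup (attachAll P act D cs) i ≡ attachAt P act D (lookup cs j)
  lookup-attachAll D (c ∷ cs) zero    = zero , refl
  lookup-attachAll D (c ∷ cs) (suc i) with lookup-attachAll D cs i
  ... | j , eq = suc j , eq

  below-lookup-attachAll : ∀ D {u} cs {i j} → lookup (attachAll P act D cs) i ≡ attachAt P act D (lookup cs j) →
                           (ℓ (rootMap (lookup (attachAll P act D cs) i)) <L ℓ u) ≡ true →
                           (ℓ (rootMap (lookup cs j)) <L ℓ u) ≡ true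
  below-lookup-attachAll D {u} cs {j = j} eq =
    subst (λ w → (ℓ w <L ℓ u) ≡ true) (trans (cong rootMap eq) (attach-root D (lookup cs j)))

  data AttachedPos (D : ℕ) (t : Tree n) {t′ : Tree n} (x : Pos t′) : Set where
    old : (x₀ : Pos t) → depth x₀ ≡ depth x → depth x₀ < D ⊎ act (mapAt t x₀) ≡ false →
          mapAt t x₀ ≡ mapAt t′ x → missing G t x₀ ≡ missing G t′ x →
          (StrictMonReach ℓ t′ x → StrictMonReach ℓ t x₀) → AttachedPos D t x
    new : (y : Pos t) → depth y ≡ D → act (mapAt t y) ≡ true → (z : Pos (P (mapAt t y))) →
          depth x ≡ D + depth z → subtreeAt t′ x ≡ subtreeAt (P (mapAt t y)) z →
          (StrictMonReach ℓ t′ x → StrictMonReach ℓ t y × StrictMonReach ℓ (P (mapAt t y)) z) →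
          AttachedPos D t x

  attached-position : ∀ D t {t′} → Height D t → t′ ≡ attachAt P act D t → (x : Pos t′) → AttachedPos D t x
  attached-position zero (node u []) _ t′≡ x with act u in active
  attached-position zero (node u []) _ refl x          | true  = new here refl active x refl refl (λ mon → tt , mon)
  attached-position zero (node u []) _ refl here       | false = old here refl (inj₂ active) refl refl (λ _ → tt)
  attached-position zero (node u []) _ refl (down () _) | false
  attached-position zero (node u (_ ∷ _)) height _ _ with () ← height (down zero here)
  attached-position (suc D) (node u cs) _ refl here =
    old here refl (inj₁ z<s) refl (cong (nbrs G u ∖_) (sym (attachAll-roots D cs))) (λ _ → tt)
  attached-position (suc D) (node u cs) height refl (down i x) with lookup-attachAll D cs i
  ... | j , eq with attached-position D (lookup cs j) (s≤s⁻¹ ∘ height ∘ down j) eq x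
  ... | old x₀ depth≡ shallowOrIdle mapAt≡ missing≡ mon =
    old (down j x₀) (cong suc depth≡) (Sum.map₁ s≤s shallowOrIdle) mapAt≡ missing≡
        (λ (below , monₓ) → below-lookup-attachAll D cs eq below , mon monₓ)
  ... | new y depth≡ active z depth≡D+ subtree≡ mon =
    new (down j y) (cong suc depth≡) active z (cong suc depth≡D+) subtree≡
        (λ (below , monₓ) → (below-lookup-attachAll D cs eq below , proj₁ (mon monₓ)) , proj₂ (mon monₓ))

module Rounds {n : ℕ} (G : Graph n) (ℓ : Fin n → Lab) (B k : ℕ) {d : ℕ}
              (higher≤d : ∀ v → ℓ v ≢ ∞ → length (filterᵇ (λ u → ℓ u ≥L ℓ v) (nbrs G v)) ≤ d)
              (d≤k : d ≤ k) where
  open Paths G ℓ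
  open Trees G
  open Pruning G ℓ k

  Good : Fin n → Set
  Good u = ℓ u ≢ ∞ × NumPathsIn G ℓ u * NumPathsIn G ℓ u ≤ B

  good-lower : ∀ {u w} → Good u → w ∈ lowerNbrs u → Good w
  good-lower {u} (ℓu≢∞ , paths²≤B) w∈ =
    <L⇒≢∞ (∈lowerNbrs⇒lower w∈) , ≤-trans (*-mono-≤ fewer fewer) paths²≤B
    where
    fewer = <⇒≤ (NumPathsIn-lower ℓu≢∞ w∈)

  good-descends : ∀ {t} → WellFormed t → Good (rootMap t) → (x : Pos t) → StrictMonReach ℓ t x → Good (mapAt t x)
  good-descends _ good here _ = good
  good-descends {node a cs} (wf roots wfs) good (down i x) (below , mon) =
    good-descends (All.lookup wfs (∈-lookup i))
                  (good-lower good (∈-filterᵇ⁺ (lower a) (RootsIn-∈ roots (∈-lookup i)) below)) x mon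

  MissingBoundAt : ℕ → (t : Tree n) → Pos t → Set
  MissingBoundAt j t x = length (missing G t x) ≤ j ⊎ initActive G B (mapAt t x) ≡ false

  MissingBoundAt-transfer : ∀ {j j′ t t′} {x : Pos t} {x′ : Pos t′} →
                            (length (missing G t x) ≤ j → length (missing G t′ x′) ≤ j′) →
                            mapAt t x ≡ mapAt t′ x′ → MissingBoundAt j t x → MissingBoundAt j′ t′ x′
  MissingBoundAt-transfer bound mapAt≡ = Sum.map bound (subst (λ w → initActive G B w ≡ false) mapAt≡)

  MissingBound : ℕ → ℕ → Tree n → Set
  MissingBound D j t = ∀ x → StrictMonReach ℓ t x → depth x < D → MissingBoundAt j t x

  record Invariant (i : ℕ) (T : Fin n → Tree n) (act : Fin n → Bool) : Set where
    field
      root-T                : ∀ u → rootMap (T u) ≡ u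
      wellFormed-T          : ∀ u → WellFormed (T u)
      initInactive⇒inactive : ∀ u → initActive G B u ≡ false → act u ≡ false
      initInactive⇒leaf     : ∀ u → initActive G B u ≡ false → T u ≡ node u []
      good⇒active           : ∀ u → Good u → initActive G B u ≡ true → act u ≡ true
      height-T              : ∀ u → act u ≡ true → Height (2 ^ i) (T u)
      missing-T             : ∀ u → Good u → act u ≡ true → MissingBound (2 ^ i) (i * k) (T u)

  invariant-init : Invariant 0 (initTree G B) (initActive G B)
  invariant-init = record
    { root-T                = root
    ; wellFormed-T          = wellFormed
    ; initInactive⇒inactive = λ _ inactive → inactive
    ; initInactive⇒leaf     = λ _ → if-false
    ; good⇒active           = λ _ _ active → active
    ; height-T              = λ u active → subst (Height 1) (sym (if-true active)) (star-height u)
    ; missing-T             = λ u _ active → subst (MissingBound 1 0) (sym (if-true active)) (star-missing u)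
    }
    where
    leaf : Fin n → Tree n
    leaf w = node w []

    star : Fin n → Tree n
    star u = node u (map leaf (nbrs G u))

    root : ∀ u → rootMap (initTree G B u) ≡ u
    root u with initActive G B u
    ... | true  = refl
    ... | false = refl

    leaves-RootsIn : ∀ ws → RootsIn (map leaf ws) ws
    leaves-RootsIn []       = []
    leaves-RootsIn (w ∷ ws) = refl ∷ leaves-RootsIn ws

    wellFormed : ∀ u → WellFormed (initTree G B u)
    wellFormed u with initActive G B u
    ... | true  = wf (leaves-RootsIn (nbrs G u)) (Allₚ.map⁺ (All.universal (λ _ → wf (minimum _) []) (nbrs G u)))
    ... | false = wf (minimum _) []

    leaf-depth : ∀ ws (i : Fin (length (map leaf ws))) (y : Pos (lookup (map leaf ws) i)) → depth y ≡ 0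
    leaf-depth (w ∷ ws) zero    here = refl
    leaf-depth (w ∷ ws) (suc i) y    = leaf-depth ws i y

    star-height : ∀ u → Height 1 (star u)
    star-height u here       = z≤n
    star-height u (down i y) = s≤s (≤-reflexive (leaf-depth (nbrs G u) i y))

    roots-leaves : ∀ ws → map rootMap (map leaf ws) ≡ ws
    roots-leaves []       = refl
    roots-leaves (w ∷ ws) = cong (w ∷_) (roots-leaves ws)

    star-missing : ∀ u → MissingBound 1 0 (star u)
    star-missing u here _ _ = inj₁ (≤-reflexive (cong length (∖-⊆ (subst (_ ∈_) (sym (roots-leaves (nbrs G u)))))))
    star-missing u (down _ _) _ (s≤s ())

  prune-leaf : ∀ {u} {p : Tree n} → LocalPrune k (node u []) p → p ≡ node u []
  prune-leaf (few _) = refl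

  module Step {i} {T : Fin n → Tree n} {act : Fin n → Bool} (inv : Invariant i T act)
              (P : Fin n → Tree n) (prune : ∀ v → LocalPrune k (T v) (P v))
              {act′ : Fin n → Bool} (act′≡ : ∀ v → act′ v ≡ (act v ∧ not (tooBig B (size (P v))))) where
    open Invariant inv

    D : ℕ
    D = 2 ^ i

    root-P : ∀ u → rootMap (P u) ≡ u
    root-P u = trans (prune-root (prune u)) (root-T u)

    wellFormed-P : ∀ u → WellFormed (P u)
    wellFormed-P u = prune-wellFormed (prune u) (wellFormed-T u)

    initInactive⇒inactive′ : ∀ {u} → initActive G B u ≡ false → act′ u ≡ false
    initInactive⇒inactive′ {u} initInactive = trans (act′≡ u) (cong (_∧ _) (initInactive⇒inactive u initInactive))

    good-root-P : ∀ {u} → Good u → Good (rootMap (P u))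
    good-root-P {u} = subst Good (sym (root-P u))

    active′⇒active : ∀ {u} → act′ u ≡ true → act u ≡ true
    active′⇒active {u} active′ = ∧≡true⇒ˡ (trans (sym (act′≡ u)) active′)

    size-P≤ : ∀ {u} → ℓ u ≢ ∞ → size (P u) ≤ NumPathsIn G ℓ u
    size-P≤ {u} ℓu≢∞ = subst (λ w → size (P u) ≤ NumPathsIn G ℓ w) (root-T u)
      (size-prune higher≤d d≤k (wellFormed-T u) (subst (λ w → ℓ w ≢ ∞) (sym (root-T u)) ℓu≢∞) (prune u))

    good⇒active′ : ∀ {u} → Good u → initActive G B u ≡ true → act′ u ≡ true
    good⇒active′ {u} good@(ℓu≢∞ , paths²≤B) initActive =
      trans (act′≡ u) (cong₂ (λ a big → a ∧ not big) (good⇒active u good initActive)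
                                                      (≤⇒<ᵇ≡false (≤-trans (*-mono-≤ size≤ size≤) paths²≤B)))
      where
      size≤ = size-P≤ ℓu≢∞

    good-inactive′⇒initInactive : ∀ {u} → Good u → act′ u ≡ false → initActive G B u ≡ false
    good-inactive′⇒initInactive {u} good inactive′ with initActive G B u in initActive
    ... | false = refl
    ... | true with () ← trans (sym (good⇒active′ good initActive)) inactive′

    height-P : ∀ {u} → act u ≡ true → Height D (P u)
    height-P {u} active y = subst (_≤ D) depth≡ (height-T u active position)
      where open Origin (prune-origin (prune u) y)

    missing-P : ∀ {u} → Good u → act u ≡ true → MissingBound D (i * k + k) (P u)
    missing-P {u} good active y mon depth<D =
      MissingBoundAt-transfer {x = position} {x′ = y} (λ bound → ≤-trans missing≤ (+-monoˡ-≤ k bound)) mapAt≡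
        (missing-T u good active position (monotone mon) (subst (_< D) (sym depth≡) depth<D))
      where open Origin (prune-origin (prune u) y)

    open Attaching G ℓ P act′ root-P

    height-attached : ∀ {u t′} → act′ u ≡ true → t′ ≡ attachAt P act′ D (P u) → Height (2 ^ suc i) t′
    height-attached {u} active′ t′≡ x
      with attached-position D (P u) (height-P (active′⇒active active′)) t′≡ x
    ... | old x₀ depth≡ _ _ _ _ =
      subst (_≤ 2 ^ suc i) depth≡ (≤-trans (height-P (active′⇒active active′) x₀) (m≤m+n D _))
    ... | new _ _ active z depth≡ _ _ =
      subst (_≤ 2 ^ suc i) (sym depth≡) (+-monoʳ-≤ D (≤-trans (height-P (active′⇒active active) z) (m≤m+n D 0)))

    missing-attached : ∀ {u t′} → Good u → act′ u ≡ true → t′ ≡ attachAt P act′ D (P u) →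
                       MissingBound (2 ^ suc i) (suc i * k) t′
    missing-attached {u} good active′ t′≡ x mon depth<
      with attached-position D (P u) (height-P (active′⇒active active′)) t′≡ x
    ... | old x₀ depth≡ (inj₁ shallow) mapAt≡ missing≡ mon₀ =
      MissingBoundAt-transfer {x = x₀} {x′ = x} (subst₂ (λ m j → length m ≤ j) missing≡ (+-comm (i * k) k)) mapAt≡
        (missing-P good (active′⇒active active′) x₀ (mon₀ mon) shallow)
    ... | old x₀ _ (inj₂ inactive′) mapAt≡ _ mon₀ =
      inj₂ (subst (λ w → initActive G B w ≡ false) mapAt≡
        (good-inactive′⇒initInactive (good-descends (wellFormed-P u) (good-root-P good) x₀ (mon₀ mon)) inactive′))
    ... | new y _ active z depth≡ subtree≡ mon₀ =
      MissingBoundAt-transfer {x = z} {x′ = x}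
        (subst₂ (λ m j → length m ≤ j) (cong rootMissing (sym subtree≡)) (+-comm (i * k) k)) (cong rootMap (sym subtree≡))
        (missing-P (good-descends (wellFormed-P u) (good-root-P good) y (proj₁ (mon₀ mon))) (active′⇒active active)
                   z (proj₂ (mon₀ mon)) (+-cancelˡ-< D _ _ (subst₂ _<_ depth≡ (cong (D +_) (+-identityʳ D)) depth<)))

  invariant-step : ∀ {i T act T′ act′} → Invariant i T act → (P : Fin n → Tree n) →
                   (∀ v → LocalPrune k (T v) (P v)) →
                   (∀ v → act′ v ≡ (act v ∧ not (tooBig B (size (P v))))) →
                   (∀ v → T′ v ≡ (if act′ v then attachAt P act′ (2 ^ i) (P v) else P v)) →
                   Invariant (suc i) T′ act′
  invariant-step {i} {T} {act} {T′} {act′} inv P prune act′≡ T′≡ = record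
    { root-T                = root
    ; wellFormed-T          = wellFormed
    ; initInactive⇒inactive = λ _ → initInactive⇒inactive′
    ; initInactive⇒leaf     = leaf
    ; good⇒active           = λ u → good⇒active′
    ; height-T              = λ u active′ → height-attached active′ (trans (T′≡ u) (if-true active′))
    ; missing-T             = λ u good active′ → missing-attached good active′ (trans (T′≡ u) (if-true active′))
    }
    where
    open Invariant inv
    open Step inv P prune act′≡
    open Attaching G ℓ P act′ root-P
    root : ∀ u → rootMap (T′ u) ≡ u
    root u with act′ u in active′
    ... | true  = trans (cong rootMap (trans (T′≡ u) (if-true active′))) (trans (attach-root D (P u)) (root-P u))
    ... | false = trans (cong rootMap (trans (T′≡ u) (if-false active′))) (root-P u)
    wellFormed : ∀ u → WellFormed (T′ u)
    wellFormed u with act′ u in active′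
    ... | true  = subst WellFormed (sym (trans (T′≡ u) (if-true active′))) (attach-wellFormed wellFormed-P D (wellFormed-P u))
    ... | false = subst WellFormed (sym (trans (T′≡ u) (if-false active′))) (wellFormed-P u)
    leaf : ∀ u → initActive G B u ≡ false → T′ u ≡ node u []
    leaf u initInactive = trans (T′≡ u) (trans (if-false (initInactive⇒inactive′ initInactive)) (prune-leaf prune-u))
      where
      prune-u : LocalPrune k (node u []) (P u)
      prune-u = subst (λ t → LocalPrune k t (P u)) (initInactive⇒leaf u initInactive) (prune u)

  invariant : ∀ {i T act} → Run G B k i T act → Invariant i T act
  invariant init                             = invariant-init
  invariant (step run P prune act′≡ T′≡) = invariant-step (invariant run) P prune act′≡ T′≡

  initInactive-leaf : ∀ {j v} {t : Tree n} → t ≡ node v [] → initActive G B v ≡ false → (x : Pos t) → MissingBoundAt j t x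
  initInactive-leaf refl inactive here = inj₂ inactive

  module _ {s : ℕ} {T : Fin n → Tree n} {act : Fin n → Bool} (run : Run G B k s T act) where
    open Invariant (invariant run)

    run-missingBoundAt : ∀ {v} → Good v → (x : Pos (T v)) → StrictMonReach ℓ (T v) x → depth x < 2 ^ s →
                           MissingBoundAt (s * k) (T v) x
    run-missingBoundAt {v} good x mon depth< with initActive G B v in init
    ... | true  = missing-T v good (good⇒active v good init) x mon depth<
    ... | false = initInactive-leaf (initInactive⇒leaf v init) init x

    run-good-mapAt : ∀ {v} → Good v → (x : Pos (T v)) → StrictMonReach ℓ (T v) x → Good (mapAt (T v) x)
    run-good-mapAt {v} good = good-descends (wellFormed-T v) (subst Good (sym (root-T v)) good)

  module _ {L : ℕ} (valid : ValidLabelling L ℓ) where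
    open Labelling valid

    deg≤lowerDegree+d : ∀ {w} → ℓ w ≢ ∞ → deg G w ≤ length (lowerNbrs w) + d
    deg≤lowerDegree+d {w} ℓw≢∞ = begin
      deg G w
        ≡⟨ Split-length (filterᵇ-Split (lower w) (nbrs G w)) ⟩
      length (lowerNbrs w) + length (filterᵇ (not ∘ lower w) (nbrs G w))
        ≤⟨ +-monoʳ-≤ (length (lowerNbrs w)) (higher≤d w ℓw≢∞) ⟩
      length (lowerNbrs w) + d ∎
      where open ≤-Reasoning

    lowerDegree<d : ∀ {w} → Good w → initActive G B w ≡ false → length (lowerNbrs w) < d
    lowerDegree<d {w} (ℓw≢∞ , paths²≤B) inactive = +-cancelˡ-≤ lo (suc lo) d (begin
      lo + suc lo           ≡⟨ +-comm lo (suc lo) ⟩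
      suc lo + lo           ≤⟨ +-monoʳ-≤ (suc lo) (m≤m*n lo (suc lo)) ⟩
      suc lo * suc lo       ≤⟨ *-mono-≤ lo<paths lo<paths ⟩
      NumPathsIn G ℓ w * NumPathsIn G ℓ w ≤⟨ paths²≤B ⟩
      B                     ≤⟨ <ᵇ≡false⇒≥ inactive ⟩
      deg G w               ≤⟨ deg≤lowerDegree+d ℓw≢∞ ⟩
      lo + d                ∎)
      where
      open ≤-Reasoning
      lo = length (lowerNbrs w)
      lo<paths = lowerDegree<NumPathsIn ℓw≢∞

    good-initInactive-deg≤ : ∀ s {w} → L < 2 ^ s → Good w → initActive G B w ≡ false → deg G w ≤ s * k
    good-initInactive-deg≤ s {w} L<2^s good@(ℓw≢∞ , _) inactive with lowerNbrs w in lower≡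
    ... | []    = begin
      deg G w                   ≤⟨ deg≤lowerDegree+d ℓw≢∞ ⟩
      length (lowerNbrs w) + d  ≡⟨ cong (λ ws → length ws + d) lower≡ ⟩
      d                         ≤⟨ d≤k ⟩
      k                         ≤⟨ k≤s*k s k (finite⇒1≤L ℓw≢∞) L<2^s ⟩
      s * k                     ∎
      where open ≤-Reasoning
    ... | c ∷ _ = begin
      deg G w                   ≤⟨ deg≤lowerDegree+d ℓw≢∞ ⟩
      length (lowerNbrs w) + d  ≤⟨ +-monoˡ-≤ d (<⇒≤ (lowerDegree<d good inactive)) ⟩
      d + d                     ≤⟨ +-mono-≤ d≤k d≤k ⟩
      k + k                     ≤⟨ k+k≤s*k s k (below⇒2≤L (∈lowerNbrs⇒lower c∈lower) ℓw≢∞) L<2^s ⟩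
      s * k                     ∎
      where
      open ≤-Reasoning
      c∈lower : c ∈ lowerNbrs w
      c∈lower = subst (c ∈_) (sym lower≡) (here refl)

    depth<2^s : ∀ {s T act v} → Run G B k s T act → L < 2 ^ s → ℓ v ≢ ∞ →
                (x : Pos (T v)) → StrictMonReach ℓ (T v) x → depth x < 2 ^ s
    depth<2^s {v = v} run L<2^s ℓv≢∞ x mon =
      let a , ℓv≡a , _ , a≤L = label≤L ℓv≢∞
          ℓroot≡a = trans (cong ℓ (Invariant.root-T (invariant run) v)) ℓv≡a
      in <-≤-trans (depth<label _ x ℓroot≡a mon) (≤-trans a≤L (<⇒≤ L<2^s))

mainTheorem8 : ∀ {n} (G : Graph n) (d L : ℕ) (ℓ : Fin n → Lab) →
    ValidLabelling L ℓ →
    (∀ v → ℓ v ≢ ∞ → length (filterᵇ (λ u → ℓ u ≥L ℓ v) (nbrs G v)) ≤ d) →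
    (B k s : ℕ) → d ≤ k → L < 2 ^ s →
    (v : Fin n) → ℓ v ≢ ∞ → NumPathsIn G ℓ v * NumPathsIn G ℓ v ≤ B →
    (T : Fin n → Tree n) (act : Fin n → Bool) → Run G B k s T act →
    (x : Pos (T v)) → StrictMonReach ℓ (T v) x →
    length (missing G (T v) x) ≤ s * k
mainTheorem8 G d L ℓ valid higher≤d B k s d≤k L<2^s v ℓv≢∞ paths²≤B T act run x mon =
  [ id , highDegree ]′ (run-missingBoundAt run good x mon (depth<2^s valid run L<2^s ℓv≢∞ x mon))
  where
  open Trees G
  open Rounds G ℓ B k higher≤d d≤k
  good : Good v
  good = ℓv≢∞ , paths²≤B
  highDegree : initActive G B (mapAt (T v) x) ≡ false → length (missing G (T v) x) ≤ s * k
  highDegree initInactive =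
    ≤-trans (missing≤deg (T v) x) (good-initInactive-deg≤ valid s L<2^s (run-good-mapAt run good x mon) initInactive)
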